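{- Every Petri net and every VASS is cover-flattable, i.e., for every such system $\mathfrak X$ and every initial state $x_0$, $(\mathfrak X,x_0)$ is cover-flattable.
   Context: A VASS of dimension $k$ is an ordered functional transition system $\mathfrak X=(Q\times\mathbb N^k,F,\leq)$ where $Q$ is a finite set of control states, $(q,x)\leq(q',x')$ iff $q=q'$ and $x\leq x'$ componentwise, and each $f\in F$ is given by $q,q'\in Q$ and $a,b\in\mathbb N^k$ with $\mathrm{dom}f=\{(q,x)\mid x\geq a\}$ and $f(q,x)=(q',x+b-a)$. A Petri net with $k$ places is the special case with a single control state (state space $\mathbb N^k$). In general, an ordered functional transition system $(X,F,\leq)$ has a partial order and a finite set $F$ of partial monotonic maps (upward-closed domain, monotonic); $x\to x'$ iff $x'=f(x)$ for some $f\in F$; $Cover_{\mathfrak X}(x_0)={\downarrow}Post^*({\downarrow}x_0)$ (downward closure of the states reachable from states below $x_0$). A system with initial state $x_1$ is flat iff there are finitely many words $w_1,\dots,w_k$ over its set of maps such that every fireable sequence of transitions from $x_1$ lies in $w_1^*\cdots w_k^*$. A monotonic flattening of $\mathfrak X_2=(X_2,F_2,\leq_2)$ is a pair $(\mathfrak X_1,\varphi)$ with $\mathfrak X_1=(X_1,F_1,\leq_1)$ a flat ordered functional transition system and $\varphi$ consisting of a monotonic map $X_1\to X_2$ and a map $F_1\to F_2$ such that $s\in\mathrm{dom}f_1$ implies $\varphi(s)\in\mathrm{dom}\,\varphi(f_1)$ and $\varphi(f_1(s))=\varphi(f_1)(\varphi(s))$. $(\mathfrak X,x_0)$ is cover-flattable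 iff there are a monotonic flattening $(\mathfrak X_1,\varphi)$ of $\mathfrak X$ and a state $x_1$ of $\mathfrak X_1$ with $\varphi(x_1)=x_0$ and $Cover_{\mathfrak X}(x_0)={\downarrow}\varphi\langle Cover_{\mathfrak X_1}(x_1)\rangle$. -}

module Defs where

open import Data.Nat using (ℕ; zero; suc; _+_; _∸_; _≤_; _≤?_)
open import Data.Nat.Properties using (≤-refl; ≤-trans; ≤-antisym; +-monoˡ-≤; ∸-monoˡ-≤)
open import Data.Fin using (Fin; _≟_)
open import Data.Vec using (Vec; []; _∷_; zipWith)
open import Data.Vec.Relation.Binary.Pointwise.Inductive as PW using (Pointwise; []; _∷_)
open import Data.List using (List; []; _∷_; _++_; concat; replicate)
import Data.Maybe
open import Data.Maybe using (Maybe; just; nothing; _>>=_)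
open import Data.Product using (Σ; _×_; _,_; ∃; proj₁; proj₂)
open import Relation.Binary using (Rel; IsPartialOrder)
open import Relation.Binary.PropositionalEquality
  using (_≡_; refl; isEquivalence; cong; cong₂; subst; subst₂; sym)
open import Relation.Nullary using (Dec; yes; no; ¬_)
open import Relation.Nullary.Decidable using (map′)
open import Function.Bundles using (_⇔_)
open import Data.Empty using (⊥-elim)

-- A partial map X ⇀ X is represented as a function X → Maybe X
-- (its domain is the set of x with  apply f x ≡ just _ ).
-- The finite set F of maps is indexed by Fin nF.

record OFTS : Set₁ where
  field
    State      : Set
    _⊑_        : Rel State _
    isPO       : IsPartialOrder _≡_ _⊑_
    nF         : ℕ
    apply      : Fin nF → State → Maybe State
    dom-up     : ∀ f {x y x'} → x ⊑ y → apply f x ≡ just x' →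
                 ∃ λ y' → apply f y ≡ just y'
    mono       : ∀ f {x y x' y'} → x ⊑ y → apply f x ≡ just x' →
                 apply f y ≡ just y' → x' ⊑ y'

  Map : Set
  Map = Fin nF

  run : List Map → State → Maybe State
  run []      x = just x
  run (f ∷ w) x = apply f x >>= run w

  Fireable : List Map → State → Set
  Fireable w x = ∃ λ y → run w x ≡ just y

  PostStarDown : State → State → Set
  PostStarDown x0 y = Σ State λ x → x ⊑ x0 × Σ (List Map) λ w → run w x ≡ just y

  -- Cover(x0) = ↓ Post*(↓ x0)
  Cover : State → State → Set
  Cover x0 z = Σ State λ y → PostStarDown x0 y × z ⊑ y

open OFTS public

-- Bounded languages  w₁* w₂* ⋯ wₖ*

_^^_ : {A : Set} → List A → ℕ → List A
u ^^ m = concat (replicate m u)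

data InStars {A : Set} : List (List A) → List A → Set where
  done : InStars [] []
  more : ∀ {u us w} (m : ℕ) → InStars us w → InStars (u ∷ us) ((u ^^ m) ++ w)

Flat : (X : OFTS) → State X → Set
Flat X x1 = Σ (List (List (Map X))) λ ws →
  ∀ (w : List (Map X)) → Fireable X w x1 → InStars ws w

record Morphism (X1 X2 : OFTS) : Set where
  field
    φS     : State X1 → State X2
    φS-mono : ∀ {s t} → _⊑_ X1 s t → _⊑_ X2 (φS s) (φS t)
    φF     : Map X1 → Map X2
    commute : ∀ f {s s'} → apply X1 f s ≡ just s' →
              apply X2 (φF f) (φS s) ≡ just (φS s')

open Morphism public

CoverFlattable : (X : OFTS) → State X → Set₁
CoverFlattable X x0 =
  Σ OFTS λ X1 → Σ (Morphism X1 X) λ φ → Σ (State X1) λ x1 →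
    Flat X1 x1 × φS φ x1 ≡ x0 ×
    (∀ z → Cover X x0 z ⇔
           (Σ (State X1) λ c → Cover X1 x1 c × _⊑_ X z (φS φ c)))

_≤ᵛ_ : ∀ {k} → Rel (Vec ℕ k) _
_≤ᵛ_ = Pointwise _≤_

≤ᵛ-refl : ∀ {k} {x : Vec ℕ k} → x ≤ᵛ x
≤ᵛ-refl {x = []} = []
≤ᵛ-refl {x = _ ∷ _} = ≤-refl ∷ ≤ᵛ-refl

≤ᵛ-trans : ∀ {k} {x y z : Vec ℕ k} → x ≤ᵛ y → y ≤ᵛ z → x ≤ᵛ z
≤ᵛ-trans [] [] = []
≤ᵛ-trans (p ∷ ps) (q ∷ qs) = ≤-trans p q ∷ ≤ᵛ-trans ps qs

≤ᵛ-antisym : ∀ {k} {x y : Vec ℕ k} → x ≤ᵛ y → y ≤ᵛ x → x ≡ y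
≤ᵛ-antisym [] [] = refl
≤ᵛ-antisym (p ∷ ps) (q ∷ qs) = cong₂ _∷_ (≤-antisym p q) (≤ᵛ-antisym ps qs)

≤ᵛ-isPO : ∀ {k} → IsPartialOrder _≡_ (_≤ᵛ_ {k})
≤ᵛ-isPO = record
  { isPreorder = record
    { isEquivalence = isEquivalence
    ; reflexive = λ { refl → ≤ᵛ-refl }
    ; trans = ≤ᵛ-trans }
  ; antisym = ≤ᵛ-antisym }

_≤ᵛ?_ : ∀ {k} (x y : Vec ℕ k) → Dec (x ≤ᵛ y)
_≤ᵛ?_ = PW.decidable _≤?_

-- x + b - a  (used only when x ≥ a)
shift : ∀ {k} → Vec ℕ k → Vec ℕ k → Vec ℕ k → Vec ℕ k
shift a b x = zipWith _+_ (zipWith _∸_ x a) b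

shift-mono : ∀ {k} (a b : Vec ℕ k) {x y} → x ≤ᵛ y → shift a b x ≤ᵛ shift a b y
shift-mono [] [] [] = []
shift-mono (a ∷ as) (b ∷ bs) (p ∷ ps) = +-monoˡ-≤ b (∸-monoˡ-≤ a p) ∷ shift-mono as bs ps

-- Petri nets with k places: state space ℕ^k; each transition is (a , b)
-- with domain {x | x ≥ a} and x ↦ x + b - a.

record PetriNet (k : ℕ) : Set where
  field
    nT   : ℕ
    pre  : Fin nT → Vec ℕ k
    post : Fin nT → Vec ℕ k


guard : ∀ {k} → Vec ℕ k → Vec ℕ k → Vec ℕ k → Maybe (Vec ℕ k)
guard a b x with a ≤ᵛ? x
... | yes _ = just (shift a b x)
... | no  _ = nothing

guard-just : ∀ {k} (a b x : Vec ℕ k) {x'} → guard a b x ≡ just x' →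
             a ≤ᵛ x × shift a b x ≡ x'
guard-just a b x eq with a ≤ᵛ? x
guard-just a b x refl | yes p = p , refl
guard-just a b x ()   | no _

guard-yes : ∀ {k} (a b x : Vec ℕ k) → a ≤ᵛ x → guard a b x ≡ just (shift a b x)
guard-yes a b x p with a ≤ᵛ? x
... | yes _ = refl
... | no ¬p = ⊥-elim (¬p p)

PetriNetOFTS : ∀ {k} → PetriNet k → OFTS
PetriNetOFTS {k} N = record
  { State = Vec ℕ k
  ; _⊑_ = _≤ᵛ_
  ; isPO = ≤ᵛ-isPO
  ; nF = nT
  ; apply = λ t → guard (pre t) (post t)
  ; dom-up = λ t {x} {y} x≤y eq →
      shift (pre t) (post t) y ,
      guard-yes (pre t) (post t) y (≤ᵛ-trans (proj₁ (guard-just (pre t) (post t) x eq)) x≤y)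
  ; mono = λ t {x} {y} x≤y eqx eqy →
      subst₂ _≤ᵛ_ (proj₂ (guard-just (pre t) (post t) x eqx))
                  (proj₂ (guard-just (pre t) (post t) y eqy))
                  (shift-mono (pre t) (post t) x≤y)
  }
  where open PetriNet N

-- A transition is given by
-- (q , q' , a , b): domain {(q , x) | x ≥ a},  (q , x) ↦ (q' , x + b - a).

record VASS (k : ℕ) : Set where
  field
    m    : ℕ
    nT   : ℕ
    src  : Fin nT → Fin m
    tgt  : Fin nT → Fin m
    pre  : Fin nT → Vec ℕ k
    post : Fin nT → Vec ℕ k

_⊑Q_ : ∀ {m k} → Rel (Fin m × Vec ℕ k) _
(q , x) ⊑Q (q' , x') = q ≡ q' × x ≤ᵛ x'

⊑Q-isPO : ∀ {m k} → IsPartialOrder _≡_ (_⊑Q_ {m} {k})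
⊑Q-isPO = record
  { isPreorder = record
    { isEquivalence = isEquivalence
    ; reflexive = λ { refl → refl , ≤ᵛ-refl }
    ; trans = λ { (refl , p) (refl , q) → refl , ≤ᵛ-trans p q } }
  ; antisym = λ { (refl , p) (_ , q) → cong (_ ,_) (≤ᵛ-antisym p q) } }

vassStep : ∀ {m k} → Fin m → Fin m → Vec ℕ k → Vec ℕ k →
           Fin m × Vec ℕ k → Maybe (Fin m × Vec ℕ k)
vassStep q q' a b (p , x) with p ≟ q
... | yes _ = Data.Maybe.map (q' ,_) (guard a b x)
... | no  _ = nothing

vassStep-just : ∀ {m k} q q' (a b : Vec ℕ k) (p : Fin m) x {s'} →
  vassStep q q' a b (p , x) ≡ just s' →
  p ≡ q × a ≤ᵛ x × (q' , shift a b x) ≡ s'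
vassStep-just q q' a b p x eq with p ≟ q
vassStep-just q q' a b p x ()  | no _
vassStep-just q q' a b p x eq  | yes p≡q with guard a b x in g
vassStep-just q q' a b p x refl | yes p≡q | just x' =
  let (a≤x , e) = guard-just a b x g in p≡q , a≤x , cong (q' ,_) e
vassStep-just q q' a b p x ()   | yes p≡q | nothing

vassStep-yes : ∀ {m k} q q' (a b : Vec ℕ k) (x : Vec ℕ k) → a ≤ᵛ x →
  vassStep {m} q q' a b (q , x) ≡ just (q' , shift a b x)
vassStep-yes q q' a b x a≤x with q ≟ q
... | no ¬r = ⊥-elim (¬r refl)
... | yes _ rewrite guard-yes a b x a≤x = refl

VASSOFTS : ∀ {k} → VASS k → OFTS
VASSOFTS {k} V = record
  { State = Fin m × Vec ℕ k
  ; _⊑_ = _⊑Q_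
  ; isPO = ⊑Q-isPO
  ; nF = nT
  ; apply = λ t → vassStep (src t) (tgt t) (pre t) (post t)
  ; dom-up = λ { t {p , x} {.p , y} (refl , x≤y) eq →
      let (p≡ , a≤x , _) = vassStep-just (src t) (tgt t) (pre t) (post t) p x eq in
      (tgt t , shift (pre t) (post t) y) ,
      subst (λ r → vassStep (src t) (tgt t) (pre t) (post t) (r , y)
                   ≡ just (tgt t , shift (pre t) (post t) y))
            (sym p≡)
            (vassStep-yes (src t) (tgt t) (pre t) (post t) y (≤ᵛ-trans a≤x x≤y)) }
  ; mono = λ { t {p , x} {.p , y} (refl , x≤y) eqx eqy →
      let (_ , _ , ex) = vassStep-just (src t) (tgt t) (pre t) (post t) p x eqx
          (_ , _ , ey) = vassStep-just (src t) (tgt t) (pre t) (post t) p y eqy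
      in subst₂ _⊑Q_ ex ey (refl , shift-mono (pre t) (post t) x≤y) }
  }
  where open VASS V

module Submission where

-- The argument goes through bounded covers: (X , x₀) has a bounded cover
-- with blocks w₁ ⋯ wₙ when every state of Cover(x₀) lies below a state
-- that x₀ itself reaches along a word of w₁* ⋯ wₙ*.
--
-- 1. A bounded cover yields a cover-flattening (boundedCover⇒coverFlattable):
--    X runs in lockstep with a control automaton accepting only words made
--    of whole iterations of the blocks, in order, followed by a prefix of a
--    block.  This product is flat and, projected to X, covers the same states.
-- 2. Every VASS has a bounded cover (KarpMiller.boundedCover).  Over the
--    ω-semantics of the VASS we explore a Karp–Miller tree.  A node strictly
--    above an ancestor accelerates the loop between them; this creates an ω,
--    so induction on the number of finite coordinates applies.  A node equal
--    to an ancestor is cut.  Branches terminate because the configurations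
--    above no ancestor are covered by finitely many components, whose counts
--    by dimension decrease lexicographically with every new node.  Each node
--    contributes a pump: a bounded language realising its ω-configuration
--    from x₀ with arbitrarily large values on the ω-coordinates.
-- 3. A Petri net is a VASS with a single control state.

open import Defs
open import Data.Empty using (⊥-elim)
open import Data.Sum using (_⊎_; inj₁; inj₂)
open import Data.Product using (Σ; _×_; _,_; ∃-syntax; proj₁; proj₂)
import Data.Product.Properties
open import Data.Product.Relation.Binary.Lex.Strict using (×-Lex; ×-wellFounded)
open import Data.Maybe using (Maybe; just; nothing; zip)
import Data.Maybe.Properties
open import Data.Nat as ℕ using (ℕ; zero; suc; _+_; _∸_; _*_; _≤_; _<_; z≤n; s≤s)
open import Data.Nat.Properties as ℕP using (≤-refl; ≤-trans; n≤1+n)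
open import Data.Nat.Induction using (<-wellFounded)
open import Data.Nat.Solver using (module +-*-Solver)
open +-*-Solver using (solve; _:+_; _:=_)
open import Algebra.Properties.CommutativeSemigroup ℕP.+-commutativeSemigroup using (xy∙z≈xz∙y; x∙yz≈y∙xz)
open import Data.Fin as F using (Fin; toℕ; combine; remQuot)
open import Data.Fin.Properties using (remQuot-combine; combine-remQuot; toℕ-injective; toℕ-fromℕ<)
open import Data.Vec as Vec using (Vec; []; _∷_)
import Data.Vec.Properties
open import Data.Vec.Relation.Binary.Pointwise.Inductive as PW using (Pointwise; []; _∷_)
open import Data.Vec.Relation.Unary.All as AllV using ([]; _∷_) renaming (All to AllV)
open import Data.List using (List; []; _∷_; _++_; map; drop; take; length; allFin; concatMap; tabulate; upTo)
open import Data.List.Properties using (++-assoc; ++-identityʳ; length-++; map-++; concatMap-++; drop-drop; take++drop≡id)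
open import Data.List.Relation.Unary.All as All using (All; []; _∷_)
import Data.List.Relation.Unary.All.Properties as AllP
open import Data.List.Relation.Unary.Any as Any using (Any; here; there; _─_)
import Data.List.Relation.Unary.Any.Properties as AnyP
open import Data.List.Membership.Propositional using (lose)
open import Data.List.Membership.Propositional.Properties using (∈-upTo⁺; ∈-allFin)
open import Function using (_on_)
open import Function.Bundles using (mk⇔)
open import Induction.WellFounded as WF using (WellFounded; Acc; acc)
import Relation.Binary.Construct.On as On
open import Relation.Binary using (IsPartialOrder)
open import Relation.Binary.PropositionalEquality
open import Relation.Nullary using (Dec; yes; no; ¬_)

module _ {A : Set} where

  stars-[] : (us : List (List A)) → InStars us []
  stars-[] []       = done
  stars-[] (u ∷ us) = more 0 (stars-[] us)

  stars-padˡ : (vs : List (List A)) {us : List (List A)} {w : List A} →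
               InStars us w → InStars (vs ++ us) w
  stars-padˡ []       p = p
  stars-padˡ (v ∷ vs) p = more 0 (stars-padˡ vs p)

  stars-padʳ : {us : List (List A)} (vs : List (List A)) {w : List A} →
               InStars us w → InStars (us ++ vs) w
  stars-padʳ vs done       = stars-[] vs
  stars-padʳ vs (more m p) = more m (stars-padʳ vs p)

  stars-++ : {us vs : List (List A)} {w w' : List A} →
             InStars us w → InStars vs w' → InStars (us ++ vs) (w ++ w')
  stars-++ done q = q
  stars-++ {w' = w'} (more {u} {w = w} m p) q =
    subst (InStars _) (sym (++-assoc (u ^^ m) w w')) (more m (stars-++ p q))

  stars-again : {u : List A} {us : List (List A)} {w : List A} →
                InStars (u ∷ us) w → InStars (u ∷ us) (u ++ w)
  stars-again {u} (more {w = w} m p) = subst (InStars _) (++-assoc u (u ^^ m) w) (more (suc m) p)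

  stars-prefix : (pre suf : List A) (rest : List (List A)) →
                 InStars (map (_∷ []) (pre ++ suf) ++ rest) pre
  stars-prefix []        suf rest = stars-[] _
  stars-prefix (e ∷ pre) suf rest = more 1 (stars-prefix pre suf rest)

  []^^ : ∀ m → ([] {A = A}) ^^ m ≡ []
  []^^ zero    = refl
  []^^ (suc m) = []^^ m

module _ (Y : OFTS) where

  run-step : ∀ f w x {y} → apply Y f x ≡ just y → run Y (f ∷ w) x ≡ run Y w y
  run-step f w x e rewrite e = refl

  run-step⁻ : ∀ f w x {z} → run Y (f ∷ w) x ≡ just z →
              ∃[ y ] apply Y f x ≡ just y × run Y w y ≡ just z
  run-step⁻ f w x eq with apply Y f x
  ... | just y = y , refl , eq

  run-++ : ∀ u v x {y} → run Y u x ≡ just y → run Y (u ++ v) x ≡ run Y v y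
  run-++ [] v x refl = refl
  run-++ (f ∷ u) v x eq with apply Y f x
  ... | just y = run-++ u v y eq

  run-++⁻ : ∀ u v x {z} → run Y (u ++ v) x ≡ just z →
            ∃[ y ] run Y u x ≡ just y × run Y v y ≡ just z
  run-++⁻ [] v x eq = x , refl , eq
  run-++⁻ (f ∷ u) v x eq with apply Y f x
  ... | just y = run-++⁻ u v y eq

  run-mono : ∀ w {x y x'} → _⊑_ Y x y → run Y w x ≡ just x' →
             ∃[ y' ] run Y w y ≡ just y' × _⊑_ Y x' y'
  run-mono [] {y = y} x⊑y refl = y , refl , x⊑y
  run-mono (f ∷ w) {x} {y} x⊑y eq with run-step⁻ f w x eq
  ... | x₁ , fx , rest with dom-up Y f x⊑y fx
  ... | y₁ , fy = let (y' , r , q) = run-mono w (mono Y f x⊑y fx fy) rest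
                  in y' , trans (run-step f w y fy) r , q

run-φ : ∀ {X₁ X₂} (φ : Morphism X₁ X₂) w s {s'} → run X₁ w s ≡ just s' →
        run X₂ (map (φF φ) w) (φS φ s) ≡ just (φS φ s')
run-φ φ [] s refl = refl
run-φ {X₁} {X₂} φ (f ∷ w) s eq with run-step⁻ X₁ f w s eq
... | y , fs , rest = trans (run-step X₂ (φF φ f) (map (φF φ) w) (φS φ s) (commute φ f fs)) (run-φ φ w y rest)

BoundedCover : (X : OFTS) → State X → List (List (Map X)) → Set
BoundedCover X x₀ ws = ∀ x w y → _⊑_ X x x₀ → run X w x ≡ just y →
  ∃[ w' ] ∃[ y' ] InStars ws w' × run X w' x₀ ≡ just y' × _⊑_ X y y'

drop-tabulate : ∀ {A : Set} {n} (f : Fin n → A) (i : Fin n) →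
                drop (toℕ i) (tabulate f) ≡ f i ∷ drop (suc (toℕ i)) (tabulate f)
drop-tabulate f F.zero    = refl
drop-tabulate f (F.suc i) = drop-tabulate (λ j → f (F.suc j)) i

drop-∷ : ∀ {A : Set} n (xs : List A) {u us} → drop n xs ≡ u ∷ us →
         n < length xs × drop (suc n) xs ≡ us
drop-∷ zero    (x ∷ xs) refl = s≤s z≤n , refl
drop-∷ (suc n) (x ∷ xs) eq   = let (lt , e) = drop-∷ n xs eq in s≤s lt , e

zip-just : ∀ {A C : Set} (ma : Maybe A) (mc : Maybe C) {a c} →
           zip ma mc ≡ just (a , c) → ma ≡ just a × mc ≡ just c
zip-just (just a) (just c) refl = refl , refl

-- The flat system for blocks ws = w₀ ⋯ w_{B-1}: X runs in lockstep with
-- a control automaton whose letters are maps of X tagged with a block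
-- index.  The control accepts exactly the words
--   w_{i₁}^{m₁} ⋯ w_{iₖ}^{mₖ} · (a prefix of w_{iₖ₊₁})   with i₁ ≤ ⋯ ≤ iₖ₊₁,
-- so the flat system is flat, while every run of X along a word of
-- w₀* ⋯ w_{B-1}* can be replayed in it.
module Flattening (X : OFTS) (ws : List (List (Map X))) where

  B : ℕ
  B = length ws

  Letter : Set
  Letter = Fin (B * nF X)

  letter : Fin B → Map X → Letter
  letter = combine

  blockOf : Letter → Fin B
  blockOf ℓ = proj₁ (remQuot {B} (nF X) ℓ)

  mapOf : Letter → Map X
  mapOf ℓ = proj₂ (remQuot {B} (nF X) ℓ)

  mapOf-letter : ∀ i t → mapOf (letter i t) ≡ t
  mapOf-letter i t = cong proj₂ (remQuot-combine i t)

  -- The n-th block ([] beyond the last one).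
  block : ℕ → List (Map X)
  block n with drop n ws
  ... | []    = []
  ... | u ∷ _ = u

  block-drop : ∀ n {u us} → drop n ws ≡ u ∷ us → block n ≡ u
  block-drop n eq rewrite eq = refl

  -- Control state (b , r): b is the last block entered, r the part of
  -- the current iteration of that block still to be executed.
  Ctrl : Set
  Ctrl = ℕ × List (Map X)

  data Step : Ctrl → Letter → Ctrl → Set where
    continue : ∀ {b i t r} → toℕ i ≡ b → Step (b , t ∷ r) (letter i t) (b , r)
    enter    : ∀ {b i t r} → b ≤ toℕ i → block (toℕ i) ≡ t ∷ r →
               Step (b , []) (letter i t) (toℕ i , r)

  enter? : Fin B → Map X → List (Map X) → Maybe Ctrl
  enter? i t []       = nothing
  enter? i t (t' ∷ r) with t F.≟ t'
  ... | yes _ = just (toℕ i , r)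
  ... | no  _ = nothing

  step' : Ctrl → Fin B → Map X → Maybe Ctrl
  step' (b , t' ∷ r) i t with toℕ i ℕ.≟ b | t F.≟ t'
  ... | yes _ | yes _ = just (b , r)
  ... | _     | _     = nothing
  step' (b , []) i t with b ℕ.≤? toℕ i
  ... | yes _ = enter? i t (block (toℕ i))
  ... | no  _ = nothing

  step : Ctrl → Letter → Maybe Ctrl
  step c ℓ = step' c (blockOf ℓ) (mapOf ℓ)

  step'-sound : ∀ c i t {c'} → step' c i t ≡ just c' → Step c (letter i t) c'
  step'-sound (b , t' ∷ r) i t eq with toℕ i ℕ.≟ b | t F.≟ t'
  step'-sound (b , t' ∷ r) i t refl | yes e | yes refl = continue e
  step'-sound (b , []) i t eq with b ℕ.≤? toℕ i
  ... | yes b≤i with block (toℕ i) in bl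
  ...   | t' ∷ r with t F.≟ t'
  step'-sound (b , []) i t refl | yes b≤i | t' ∷ r | yes refl = enter b≤i bl

  step-sound : ∀ c ℓ {c'} → step c ℓ ≡ just c' → Step c ℓ c'
  step-sound c ℓ eq = subst (λ ℓ' → Step c ℓ' _) (combine-remQuot {B} (nF X) ℓ)
                            (step'-sound c (blockOf ℓ) (mapOf ℓ) eq)

  step-letter : ∀ c i t → step c (letter i t) ≡ step' c i t
  step-letter c i t = cong (λ it → step' c (proj₁ it) (proj₂ it)) (remQuot-combine i t)

  step-continue : ∀ {b} i t r → toℕ i ≡ b → step (b , t ∷ r) (letter i t) ≡ just (b , r)
  step-continue {b} i t r e rewrite step-letter (b , t ∷ r) i t with toℕ i ℕ.≟ b | t F.≟ t
  ... | yes _ | yes _ = refl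
  ... | no ne | _     = ⊥-elim (ne e)
  ... | _     | no ne = ⊥-elim (ne refl)

  step-enter : ∀ {b} i t r → b ≤ toℕ i → block (toℕ i) ≡ t ∷ r →
               step (b , []) (letter i t) ≡ just (toℕ i , r)
  step-enter {b} i t r b≤i bl rewrite step-letter (b , []) i t with b ℕ.≤? toℕ i
  ... | no b≰i = ⊥-elim (b≰i b≤i)
  ... | yes _ rewrite bl with t F.≟ t
  ...   | yes _ = refl
  ...   | no ne = ⊥-elim (ne refl)

  State₁ : Set
  State₁ = State X × Ctrl

  _⊑₁_ : State₁ → State₁ → Set
  (x , c) ⊑₁ (y , d) = c ≡ d × _⊑_ X x y

  private module PX = IsPartialOrder (isPO X)

  apply₁ : Letter → State₁ → Maybe State₁
  apply₁ ℓ (x , c) = zip (apply X (mapOf ℓ) x) (step c ℓ)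

  X₁ : OFTS
  X₁ = record
    { State  = State₁
    ; _⊑_    = _⊑₁_
    ; isPO   = record
      { isPreorder = record
        { isEquivalence = isEquivalence
        ; reflexive     = λ { refl → refl , PX.refl }
        ; trans         = λ { (refl , p) (refl , q) → refl , PX.trans p q } }
      ; antisym = λ { (refl , p) (_ , q) → cong (_, _) (PX.antisym p q) } }
    ; nF     = B * nF X
    ; apply  = apply₁
    ; dom-up = λ { ℓ {x , c} {y , .c} (refl , x⊑y) eq →
        let (fx , sc) = zip-just (apply X (mapOf ℓ) x) (step c ℓ) eq
            (y' , fy) = dom-up X (mapOf ℓ) x⊑y fx
        in _ , cong₂ zip fy sc }
    ; mono   = λ { ℓ {x , c} {y , .c} (refl , x⊑y) eqx eqy →
        let (fx , sx) = zip-just (apply X (mapOf ℓ) x) (step c ℓ) eqx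
            (fy , sy) = zip-just (apply X (mapOf ℓ) y) (step c ℓ) eqy
        in Data.Maybe.Properties.just-injective (trans (sym sx) sy) , mono X (mapOf ℓ) x⊑y fx fy }
    }

  φ : Morphism X₁ X
  φ = record
    { φS      = proj₁
    ; φS-mono = proj₂
    ; φF      = mapOf
    ; commute = λ { ℓ {x , c} eq → proj₁ (zip-just (apply X (mapOf ℓ) x) (step c ℓ) eq) } }

  apply₁-letter : ∀ i t x c {y c'} → apply X t x ≡ just y → step c (letter i t) ≡ just c' →
                  apply₁ (letter i t) (x , c) ≡ just (y , c')
  apply₁-letter i t x c tx sc rewrite mapOf-letter i t | tx | sc = refl

  data Accepts : Ctrl → List Letter → Set where
    []  : ∀ {c} → Accepts c []
    _∷_ : ∀ {c ℓ c' w} → Step c ℓ c' → Accepts c' w → Accepts c (ℓ ∷ w)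

  fireable⇒accepted : ∀ w x c {s} → run X₁ w (x , c) ≡ just s → Accepts c w
  fireable⇒accepted []      x c eq = []
  fireable⇒accepted (ℓ ∷ w) x c eq with run-step⁻ X₁ ℓ w (x , c) eq
  ... | (y , c') , fired , rest =
    step-sound c ℓ (proj₂ (zip-just (apply X (mapOf ℓ) x) (step c ℓ) fired))
    ∷ fireable⇒accepted w y c' rest

  -- The flat language: block i contributes  (Eᵢ)* e₁* ⋯ eₙ*  where
  -- Eᵢ = e₁ ⋯ eₙ is block i written in letters; Suf b collects blocks ≥ b.
  E : Fin B → List Letter
  E i = map (letter i) (block (toℕ i))

  lang : Fin B → List (List Letter)
  lang i = E i ∷ map (_∷ []) (E i)

  Suf : ℕ → List (List Letter)
  Suf b = concatMap lang (drop b (allFin B))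

  Suf-unfold : ∀ i → Suf (toℕ i) ≡ lang i ++ Suf (suc (toℕ i))
  Suf-unfold i = cong (concatMap lang) (drop-tabulate (λ j → j) i)

  Suf-antitone : ∀ {b b' w} → b ≤ b' → InStars (Suf b') w → InStars (Suf b) w
  Suf-antitone {b} {b'} {w} b≤b' p =
    subst (λ z → InStars z w) (sym Suf-split) (stars-padˡ (concatMap lang skipped) p)
    where
      d = b' ∸ b
      blocks = drop b (allFin B)
      skipped = take d blocks
      Suf-split : Suf b ≡ concatMap lang skipped ++ Suf b'
      Suf-split = begin
        concatMap lang blocks
          ≡⟨ cong (concatMap lang) (sym (take++drop≡id d blocks)) ⟩
        concatMap lang (skipped ++ drop d blocks)
          ≡⟨ concatMap-++ lang skipped (drop d blocks) ⟩
        concatMap lang skipped ++ concatMap lang (drop d blocks)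
          ≡⟨ cong (λ z → concatMap lang skipped ++ concatMap lang z) (drop-drop b d (allFin B)) ⟩
        concatMap lang skipped ++ Suf (b + d)
          ≡⟨ cong (λ z → concatMap lang skipped ++ Suf z) (ℕP.m+[n∸m]≡n b≤b') ⟩
        concatMap lang skipped ++ Suf b' ∎
        where open ≡-Reasoning

  -- Accepted words lie in the flat language.  `accepted-inside` handles
  -- an iteration of block i of which `pre` has been read and `r` remains.
  mutual
    accepted-boundary : ∀ {b w} → Accepts (b , []) w → InStars (Suf b) w
    accepted-boundary [] = stars-[] _
    accepted-boundary {w = _ ∷ w} (enter {i = i} {t} {r} b≤i bl ∷ rest) =
      Suf-antitone b≤i (subst (λ z → InStars z (letter i t ∷ w)) (sym (Suf-unfold i))
                              (accepted-inside i (letter i t ∷ []) r (cong (map (letter i)) bl) rest))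

    accepted-inside : ∀ i pre r {w} → E i ≡ pre ++ map (letter i) r → Accepts (toℕ i , r) w →
                      InStars (lang i ++ Suf (suc (toℕ i))) (pre ++ w)
    accepted-inside i pre [] {w} e rest =
      subst (λ z → InStars _ (z ++ w)) (trans e (++-identityʳ pre))
            (stars-again (subst (λ z → InStars z w) (Suf-unfold i) (accepted-boundary rest)))
    accepted-inside i pre (t ∷ r) e [] =
      subst (λ z → InStars _ z) (sym (++-identityʳ pre))
            (subst (λ z → InStars (E i ∷ map (_∷ []) z ++ Suf (suc (toℕ i))) pre) (sym e)
                   (more 0 (stars-prefix pre (map (letter i) (t ∷ r)) _)))
    accepted-inside i pre (t ∷ r) e (continue {i = i'} i'≡i ∷ rest) with toℕ-injective i'≡i
    ... | refl = subst (InStars _) (++-assoc pre (letter i t ∷ []) _)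
                       (accepted-inside i (pre ++ letter i t ∷ []) r
                          (trans e (sym (++-assoc pre (letter i t ∷ []) (map (letter i) r)))) rest)

  flat : ∀ x → Flat X₁ (x , (0 , []))
  flat x = Suf 0 , λ w (_ , r) → accepted-boundary (fireable⇒accepted w x (0 , []) r)

  run-rest : ∀ i r {x x'} → run X r x ≡ just x' →
             run X₁ (map (letter i) r) (x , (toℕ i , r)) ≡ just (x' , (toℕ i , []))
  run-rest i []      refl = refl
  run-rest i (t ∷ r) {x} eq with run-step⁻ X t r x eq
  ... | y , tx , rest =
    trans (run-step X₁ (letter i t) (map (letter i) r) (x , (toℕ i , t ∷ r))
                    (apply₁-letter i t x (toℕ i , t ∷ r) tx (step-continue i t r refl)))
          (run-rest i r rest)

  run-iteration : ∀ i t r {b x x'} → b ≤ toℕ i → block (toℕ i) ≡ t ∷ r → run X (t ∷ r) x ≡ just x' →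
                  run X₁ (map (letter i) (t ∷ r)) (x , (b , [])) ≡ just (x' , (toℕ i , []))
  run-iteration i t r {b} {x} b≤i bl eq with run-step⁻ X t r x eq
  ... | y , tx , rest =
    trans (run-step X₁ (letter i t) (map (letter i) r) (x , (b , [])) (apply₁-letter i t x (b , []) tx (step-enter i t r b≤i bl)))
          (run-rest i r rest)

  run-iterations : ∀ i t r → block (toℕ i) ≡ t ∷ r → ∀ m {b x x'} → b ≤ toℕ i →
                   run X ((t ∷ r) ^^ m) x ≡ just x' →
                   ∃[ b' ] b' ≤ toℕ i × run X₁ (map (letter i) ((t ∷ r) ^^ m)) (x , (b , [])) ≡ just (x' , (b' , []))
  run-iterations i t r bl zero    b≤i refl = _ , b≤i , refl
  run-iterations i t r bl (suc m) {b} {x} b≤i eq with run-++⁻ X (t ∷ r) ((t ∷ r) ^^ m) x eq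
  ... | y , once , rest with run-iterations i t r bl m ≤-refl rest
  ...   | b' , b'≤i , replay =
    b' , b'≤i ,
    trans (cong (λ z → run X₁ z (x , (b , []))) (map-++ (letter i) (t ∷ r) ((t ∷ r) ^^ m)))
          (trans (run-++ X₁ (map (letter i) (t ∷ r)) (map (letter i) ((t ∷ r) ^^ m)) (x , (b , []))
                         (run-iteration i t r b≤i bl once))
                 replay)

  run-power : ∀ i m {b x x'} → b ≤ toℕ i → run X (block (toℕ i) ^^ m) x ≡ just x' →
              ∃[ w₁ ] ∃[ b' ] b' ≤ toℕ i × run X₁ w₁ (x , (b , [])) ≡ just (x' , (b' , []))
  run-power i m b≤i eq with block (toℕ i) in bl
  ... | t ∷ r = map (letter i) ((t ∷ r) ^^ m) , run-iterations i t r bl m b≤i eq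
  ... | [] rewrite []^^ {A = Map X} m with eq
  ...   | refl = [] , _ , b≤i , refl

  realise : ∀ n {us w b x y} → drop n ws ≡ us → b ≤ n → InStars us w → run X w x ≡ just y →
            ∃[ w₁ ] ∃[ b' ] run X₁ w₁ (x , (b , [])) ≡ just (y , (b' , []))
  realise n eq b≤n done refl = [] , _ , refl
  realise n {b = b} {x} eq b≤n (more {u} {us} {w} m p) r
    with run-++⁻ X (u ^^ m) w x r | drop-∷ n ws eq
  ... | x' , r₁ , r₂ | n<B , eq' with F.fromℕ< n<B | toℕ-fromℕ< n<B
  ...   | i | refl with run-power i m b≤n (subst (λ z → run X (z ^^ m) x ≡ _) (sym (block-drop (toℕ i) eq)) r₁)
  ...     | w₁ , b₁ , b₁≤i , q₁ with realise (suc (toℕ i)) eq' (≤-trans b₁≤i (n≤1+n _)) p r₂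
  ...       | w₂ , b₂ , q₂ = w₁ ++ w₂ , b₂ , trans (run-++ X₁ w₁ w₂ (x , (b , [])) q₁) q₂

boundedCover⇒coverFlattable : ∀ X x₀ ws → BoundedCover X x₀ ws → CoverFlattable X x₀
boundedCover⇒coverFlattable X x₀ ws bc =
  X₁ , φ , (x₀ , (0 , [])) , flat x₀ , refl , λ z → mk⇔ (cover⇒ z) (⇒cover z)
  where
    open Flattening X ws
    module PX = IsPartialOrder (isPO X)

    cover⇒ : ∀ z → Cover X x₀ z → Σ (State X₁) λ c → Cover X₁ (x₀ , (0 , [])) c × _⊑_ X z (proj₁ c)
    cover⇒ z (y , (x , x⊑x₀ , w , r) , z⊑y) with bc x w y x⊑x₀ r
    ... | w' , y' , w'∈ , r' , y⊑y' with realise 0 refl z≤n w'∈ r'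
    ... | w₁ , b , r₁ =
      (y' , (b , [])) , ((y' , (b , [])) , ((x₀ , (0 , [])) , (refl , PX.refl) , w₁ , r₁) , (refl , PX.refl)) ,
      PX.trans z⊑y y⊑y'

    ⇒cover : ∀ z → (Σ (State X₁) λ c → Cover X₁ (x₀ , (0 , [])) c × _⊑_ X z (proj₁ c)) → Cover X x₀ z
    ⇒cover z (c , (y₁ , (s , s⊑ , w₁ , r₁) , c⊑y₁) , z⊑c) =
      proj₁ y₁ , (proj₁ s , proj₂ s⊑ , map mapOf w₁ , run-φ φ w₁ s r₁) , PX.trans z⊑c (proj₂ c⊑y₁)

-- ℕ extended with a top element ω, represented by nothing.
ℕω : Set
ℕω = Maybe ℕ

data _≤ω_ : ℕω → ℕω → Set where
  fin : ∀ {a b} → a ≤ b → just a ≤ω just b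
  top : ∀ {x} → x ≤ω nothing

≤ω-refl : ∀ {x} → x ≤ω x
≤ω-refl {just x}  = fin ≤-refl
≤ω-refl {nothing} = top

≤ω-trans : ∀ {x y z} → x ≤ω y → y ≤ω z → x ≤ω z
≤ω-trans (fin p) (fin q) = fin (≤-trans p q)
≤ω-trans _       top     = top

≤ω-antisym : ∀ {x y} → x ≤ω y → y ≤ω x → x ≡ y
≤ω-antisym (fin p) (fin q) = cong just (ℕP.≤-antisym p q)
≤ω-antisym top     top     = refl

_≤ω?_ : ∀ x y → Dec (x ≤ω y)
just a  ≤ω? just b with a ℕ.≤? b
... | yes p = yes (fin p)
... | no ¬p = no λ { (fin p) → ¬p p }
just a  ≤ω? nothing = yes top
nothing ≤ω? just b  = no λ ()
nothing ≤ω? nothing = yes top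

_≤Ω_ : ∀ {n} → Vec ℕω n → Vec ℕω n → Set
_≤Ω_ = Pointwise _≤ω_

≤Ω-refl : ∀ {n} {X : Vec ℕω n} → X ≤Ω X
≤Ω-refl = PW.refl ≤ω-refl

≤Ω-trans : ∀ {n} {X Y Z : Vec ℕω n} → X ≤Ω Y → Y ≤Ω Z → X ≤Ω Z
≤Ω-trans = PW.trans ≤ω-trans

≤Ω-antisym : ∀ {n} {X Y : Vec ℕω n} → X ≤Ω Y → Y ≤Ω X → X ≡ Y
≤Ω-antisym []       []       = refl
≤Ω-antisym (p ∷ ps) (q ∷ qs) = cong₂ _∷_ (≤ω-antisym p q) (≤Ω-antisym ps qs)

shiftω : ℕ → ℕ → ℕω → ℕω
shiftω a b (just x) = just (x ∸ a + b)
shiftω a b nothing  = nothing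

shiftΩ : ∀ {n} → Vec ℕ n → Vec ℕ n → Vec ℕω n → Vec ℕω n
shiftΩ []       []       []       = []
shiftΩ (a ∷ as) (b ∷ bs) (x ∷ xs) = shiftω a b x ∷ shiftΩ as bs xs

shiftΩ-mono : ∀ {n} (a b : Vec ℕ n) {X Y} → X ≤Ω Y → shiftΩ a b X ≤Ω shiftΩ a b Y
shiftΩ-mono []       []       []           = []
shiftΩ-mono (a ∷ as) (b ∷ bs) (fin p ∷ ps) = fin (ℕP.+-monoˡ-≤ b (ℕP.∸-monoˡ-≤ a p)) ∷ shiftΩ-mono as bs ps
shiftΩ-mono (a ∷ as) (b ∷ bs) (top   ∷ ps) = top ∷ shiftΩ-mono as bs ps

Enabled : ∀ {n} → Vec ℕ n → Vec ℕω n → Set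
Enabled = Pointwise (λ a x → just a ≤ω x)

data SameShape : ℕω → ℕω → Set where
  fin : ∀ {a b} → SameShape (just a) (just b)
  ω   : SameShape nothing nothing

SameShapeΩ : ∀ {n} → Vec ℕω n → Vec ℕω n → Set
SameShapeΩ = Pointwise SameShape

SameShapeΩ-refl : ∀ {n} {X : Vec ℕω n} → SameShapeΩ X X
SameShapeΩ-refl = PW.refl λ { {just _} → fin ; {nothing} → ω }

SameShapeΩ-trans : ∀ {n} {X Y Z : Vec ℕω n} → SameShapeΩ X Y → SameShapeΩ Y Z → SameShapeΩ X Z
SameShapeΩ-trans = PW.trans λ { fin fin → fin ; ω ω → ω }

SameShapeΩ-shift : ∀ {n} (a b : Vec ℕ n) X → SameShapeΩ X (shiftΩ a b X)
SameShapeΩ-shift []       []       []            = []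
SameShapeΩ-shift (a ∷ as) (b ∷ bs) (just x  ∷ X) = fin ∷ SameShapeΩ-shift as bs X
SameShapeΩ-shift (a ∷ as) (b ∷ bs) (nothing ∷ X) = ω ∷ SameShapeΩ-shift as bs X

finite : ∀ {n} → Vec ℕω n → ℕ
finite []            = 0
finite (just _ ∷ X)  = suc (finite X)
finite (nothing ∷ X) = finite X

finite-SameShape : ∀ {n} {X Y : Vec ℕω n} → SameShapeΩ X Y → finite X ≡ finite Y
finite-SameShape []         = refl
finite-SameShape (fin ∷ ps) = cong suc (finite-SameShape ps)
finite-SameShape (ω   ∷ ps) = finite-SameShape ps

data Dominates (N : ℕ) : ℕ → ℕω → Set where
  fin : ∀ {a v} → a ≤ v → Dominates N v (just a)
  ω   : ∀ {v} → N ≤ v → Dominates N v nothing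

DominatesΩ : ℕ → ∀ {n} → Vec ℕ n → Vec ℕω n → Set
DominatesΩ N = Pointwise (Dominates N)

DominatesΩ-weaken : ∀ {N N' n} {v : Vec ℕ n} {X} → N' ≤ N → DominatesΩ N v X → DominatesΩ N' v X
DominatesΩ-weaken N'≤N = PW.map λ { (fin p) → fin p ; (ω p) → ω (≤-trans N'≤N p) }

data Pointwise₄ {A B C D : Set} (R : A → B → C → D → Set) :
                ∀ {n} → Vec A n → Vec B n → Vec C n → Vec D n → Set where
  []  : Pointwise₄ R [] [] [] []
  _∷_ : ∀ {n a b c d} {as : Vec A n} {bs cs ds} →
        R a b c d → Pointwise₄ R as bs cs ds → Pointwise₄ R (a ∷ as) (b ∷ bs) (c ∷ cs) (d ∷ ds)

-- The concrete move v ⇝ v' tracks the ω-move x ⇝ x': it has the same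
-- effect on finite coordinates and ends at least at T on ω-coordinates.
data Tracks (T : ℕ) : ℕ → ℕω → ℕ → ℕω → Set where
  fin : ∀ {v a v' a'} → v' + a ≡ v + a' → Tracks T v (just a) v' (just a')
  ω   : ∀ {v v'} → T ≤ v' → Tracks T v nothing v' nothing

TracksΩ : ℕ → ∀ {n} → Vec ℕ n → Vec ℕω n → Vec ℕ n → Vec ℕω n → Set
TracksΩ T = Pointwise₄ (Tracks T)

tracks-refl : ∀ {n T N} {v : Vec ℕ n} {X} → T ≤ N → DominatesΩ N v X → TracksΩ T v X v X
tracks-refl T≤N []           = []
tracks-refl T≤N (fin p ∷ ps) = fin refl ∷ tracks-refl T≤N ps
tracks-refl T≤N (ω p ∷ ps)   = ω (≤-trans T≤N p) ∷ tracks-refl T≤N ps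

tracks-dominates : ∀ {n T N} {v : Vec ℕ n} {X v' X'} → DominatesΩ N v X → TracksΩ T v X v' X' → DominatesΩ T v' X'
tracks-dominates [] [] = []
tracks-dominates {v = v ∷ _} {v' = v' ∷ _} (fin {a} a≤v ∷ ps) (fin {a' = a'} e ∷ ts) =
  fin (ℕP.+-cancelˡ-≤ a a' v' (begin
    a + a'  ≤⟨ ℕP.+-monoˡ-≤ a' a≤v ⟩
    v + a'  ≡⟨ sym e ⟩
    v' + a  ≡⟨ ℕP.+-comm v' a ⟩
    a + v'  ∎)) ∷ tracks-dominates ps ts
  where open ℕP.≤-Reasoning
tracks-dominates (ω _ ∷ ps) (ω T≤v' ∷ ts) = ω T≤v' ∷ tracks-dominates ps ts

tracks-trans : ∀ {n T₁ T} {v : Vec ℕ n} {X v₁ X₁ v' X'} →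
               TracksΩ T₁ v X v₁ X₁ → TracksΩ T v₁ X₁ v' X' → TracksΩ T v X v' X'
tracks-trans [] [] = []
tracks-trans {v = v ∷ _} {v₁ = v₁ ∷ _} {v' = v' ∷ _} (fin {a = a} {a' = a₁} e₁ ∷ ts) (fin {a' = a'} e₂ ∷ us) =
  fin (ℕP.+-cancelʳ-≡ a₁ (v' + a) (v + a') (begin
    v' + a + a₁   ≡⟨ swap v' a a₁ ⟩
    v' + a₁ + a   ≡⟨ cong (_+ a) e₂ ⟩
    v₁ + a' + a   ≡⟨ swap v₁ a' a ⟩
    v₁ + a + a'   ≡⟨ cong (_+ a') e₁ ⟩
    v + a₁ + a'   ≡⟨ swap v a₁ a' ⟩
    v + a' + a₁   ∎)) ∷ tracks-trans ts us
  where
    open ≡-Reasoning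
    swap : ∀ x y z → x + y + z ≡ x + z + y
    swap = xy∙z≈xz∙y
tracks-trans (ω _ ∷ ts) (ω T≤v' ∷ us) = ω T≤v' ∷ tracks-trans ts us

track-step : ∀ T c a b v x → a ≤ c → just a ≤ω x → Dominates (c + T) v x →
             a ≤ v × Tracks T v x (v ∸ a + b) (shiftω a b x)
track-step T c a b v (just m) a≤c (fin a≤m) (fin m≤v) =
  a≤v , fin (begin
    v ∸ a + b + m             ≡⟨ cong (v ∸ a + b +_) (sym (ℕP.m∸n+n≡m a≤m)) ⟩
    v ∸ a + b + (m ∸ a + a)   ≡⟨ solve 4 (λ p b q a → (p :+ b) :+ (q :+ a) := (p :+ a) :+ (q :+ b))
                                         refl (v ∸ a) b (m ∸ a) a ⟩
    v ∸ a + a + (m ∸ a + b)   ≡⟨ cong (_+ (m ∸ a + b)) (ℕP.m∸n+n≡m a≤v) ⟩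
    v + (m ∸ a + b)           ∎)
  where
    open ≡-Reasoning
    a≤v = ≤-trans a≤m m≤v
track-step T c a b v nothing a≤c top (ω c+T≤v) =
  ≤-trans a≤c (≤-trans (ℕP.m≤m+n c T) c+T≤v) , ω (begin
    T             ≡⟨ sym (ℕP.m+n∸m≡n c T) ⟩
    c + T ∸ c     ≤⟨ ℕP.∸-monoʳ-≤ (c + T) a≤c ⟩
    c + T ∸ a     ≤⟨ ℕP.∸-monoˡ-≤ a c+T≤v ⟩
    v ∸ a         ≤⟨ ℕP.m≤m+n (v ∸ a) b ⟩
    v ∸ a + b     ∎)
  where open ℕP.≤-Reasoning

track-stepΩ : ∀ {n} T c (a b v : Vec ℕ n) X → AllV (_≤ c) a → Enabled a X → DominatesΩ (c + T) v X →
              a ≤ᵛ v × TracksΩ T v X (shift a b v) (shiftΩ a b X)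
track-stepΩ T c [] [] [] [] [] [] [] = [] , []
track-stepΩ T c (a ∷ as) (b ∷ bs) (v ∷ vs) (x ∷ xs) (p ∷ ps) (e ∷ es) (d ∷ ds) =
  let (a≤v , t) = track-step T c a b v x p e d
      (as≤vs , ts) = track-stepΩ T c as bs vs xs ps es ds
  in (a≤v ∷ as≤vs) , (t ∷ ts)

≤-sum : ∀ {n} (a : Vec ℕ n) → AllV (_≤ Vec.sum a) a
≤-sum []      = []
≤-sum (x ∷ a) = ℕP.m≤m+n x (Vec.sum a) ∷ AllV.map (λ p → ≤-trans p (ℕP.m≤n+m (Vec.sum a) x)) (≤-sum a)

data Grows : ℕω → ℕω → Set where
  fin : ∀ {a b} → a ≤ b → Grows (just a) (just b)
  ω   : Grows nothing nothing

GrowsΩ : ∀ {n} → Vec ℕω n → Vec ℕω n → Set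
GrowsΩ = Pointwise Grows

grows : ∀ {n} {H C : Vec ℕω n} → H ≤Ω C → SameShapeΩ H C → GrowsΩ H C
grows []           []         = []
grows (fin p ∷ ps) (fin ∷ ss) = fin p ∷ grows ps ss
grows (top ∷ ps)   (ω ∷ ss)   = ω ∷ grows ps ss

accelerateω : ℕω → ℕω → ℕω
accelerateω (just a) (just b) with a ℕ.<? b
... | yes _ = nothing
... | no  _ = just b
accelerateω _ y = y

accelerate : ∀ {n} → Vec ℕω n → Vec ℕω n → Vec ℕω n
accelerate []       []       = []
accelerate (x ∷ xs) (y ∷ ys) = accelerateω x y ∷ accelerate xs ys

accelerate-≥ : ∀ {n} {H C : Vec ℕω n} → GrowsΩ H C → C ≤Ω accelerate H C
accelerate-≥ [] = []
accelerate-≥ (fin {a} {b} p ∷ ps) with a ℕ.<? b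
... | yes _ = top ∷ accelerate-≥ ps
... | no  _ = ≤ω-refl ∷ accelerate-≥ ps
accelerate-≥ (ω ∷ ps) = top ∷ accelerate-≥ ps

finite-accelerate-≤ : ∀ {n} {H C : Vec ℕω n} → GrowsΩ H C → finite (accelerate H C) ≤ finite H
finite-accelerate-≤ [] = z≤n
finite-accelerate-≤ (fin {a} {b} p ∷ ps) with a ℕ.<? b
... | yes _ = ≤-trans (finite-accelerate-≤ ps) (n≤1+n _)
... | no  _ = s≤s (finite-accelerate-≤ ps)
finite-accelerate-≤ (ω ∷ ps) = finite-accelerate-≤ ps

finite-accelerate-< : ∀ {n} {H C : Vec ℕω n} → GrowsΩ H C → H ≢ C → finite (accelerate H C) < finite H
finite-accelerate-< [] H≢C = ⊥-elim (H≢C refl)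
finite-accelerate-< {H = just a ∷ H} {just b ∷ C} (fin p ∷ ps) H≢C with a ℕ.<? b
... | yes _ = s≤s (finite-accelerate-≤ ps)
... | no a≮b with ℕP.≤-antisym p (ℕP.≮⇒≥ a≮b)
...   | refl = s≤s (finite-accelerate-< ps (λ e → H≢C (cong (just a ∷_) e)))
finite-accelerate-< (ω ∷ ps) H≢C = finite-accelerate-< ps (λ e → H≢C (cong (nothing ∷_) e))

-- vj is the result of iterating the loop h ⇝ c j times from v:
-- finite coordinates changed by j·(c - h), ω coordinates at least T.
data Iterated (j T : ℕ) : ℕ → ℕω → ℕω → ℕ → Set where
  fin : ∀ {v a b vj} → vj + j * a ≡ v + j * b → Iterated j T v (just a) (just b) vj
  ω   : ∀ {v vj} → T ≤ vj → Iterated j T v nothing nothing vj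

IteratedΩ : ℕ → ℕ → ∀ {n} → Vec ℕ n → Vec ℕω n → Vec ℕω n → Vec ℕ n → Set
IteratedΩ j T = Pointwise₄ (Iterated j T)

iterated-zero : ∀ {n T} {v : Vec ℕ n} {H C} → GrowsΩ H C → DominatesΩ T v H → IteratedΩ 0 T v H C v
iterated-zero []           []         = []
iterated-zero (fin _ ∷ ps) (fin _ ∷ ds) = fin refl ∷ iterated-zero ps ds
iterated-zero (ω ∷ ps)     (ω T≤v ∷ ds) = ω T≤v ∷ iterated-zero ps ds

loop-dominates : ∀ {n T₁ N} {v : Vec ℕ n} {H C v₁} → GrowsΩ H C → DominatesΩ N v H →
                 TracksΩ T₁ v H v₁ C → DominatesΩ T₁ v₁ H
loop-dominates [] [] [] = []
loop-dominates {v = v ∷ _} {v₁ = v₁ ∷ _} (fin {a} {b} a≤b ∷ ps) (fin a≤v ∷ ds) (fin e ∷ ts) =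
  fin (ℕP.+-cancelʳ-≤ a a v₁ (≤-trans (ℕP.+-mono-≤ a≤v a≤b) (ℕP.≤-reflexive (sym e)))) ∷ loop-dominates ps ds ts
loop-dominates (ω ∷ ps) (ω _ ∷ ds) (ω T≤v₁ ∷ ts) = ω T≤v₁ ∷ loop-dominates ps ds ts

iterated-suc : ∀ {n j T₁ T} {v : Vec ℕ n} {H C v₁ vj} → TracksΩ T₁ v H v₁ C → IteratedΩ j T v₁ H C vj →
               IteratedΩ (suc j) T v H C vj
iterated-suc [] [] = []
iterated-suc {j = j} {v = v ∷ _} {v₁ = v₁ ∷ _} {vj = vj ∷ _} (fin {a = a} {a' = b} e ∷ ts) (fin e₂ ∷ is) =
  fin (ℕP.+-cancelʳ-≡ a _ _ (begin
    vj + (a + j * a) + a   ≡⟨ solve 3 (λ x y z → (x :+ (y :+ z)) :+ y := (x :+ z) :+ (y :+ y)) refl vj a (j * a) ⟩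
    vj + j * a + (a + a)   ≡⟨ cong (_+ (a + a)) e₂ ⟩
    v₁ + j * b + (a + a)   ≡⟨ solve 3 (λ x y z → (x :+ y) :+ (z :+ z) := ((x :+ z) :+ y) :+ z) refl v₁ (j * b) a ⟩
    v₁ + a + j * b + a     ≡⟨ cong (λ z → z + j * b + a) e ⟩
    v + b + j * b + a      ≡⟨ cong (_+ a) (ℕP.+-assoc v b (j * b)) ⟩
    v + (b + j * b) + a    ∎)) ∷ iterated-suc ts is
  where open ≡-Reasoning
iterated-suc (ω _ ∷ ts) (ω T≤vj ∷ is) = ω T≤vj ∷ iterated-suc ts is

-- Iterating a growing loop n times from v makes every coordinate that
-- grows at least n, so the result dominates the accelerated vector at n.
iterated-dominates : ∀ {k} n {v : Vec ℕ k} {H C vn} → GrowsΩ H C → DominatesΩ 0 v H →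
                     IteratedΩ n n v H C vn → DominatesΩ n vn (accelerate H C)
iterated-dominates n [] [] [] = []
iterated-dominates n (p ∷ ps) (d ∷ ds) (i ∷ is) = coordinate p d i ∷ iterated-dominates n ps ds is
  where
    coordinate : ∀ {v h c vn} → Grows h c → Dominates 0 v h → Iterated n n v h c vn →
                 Dominates n vn (accelerateω h c)
    coordinate {v} {just a} {just b} {vn} (fin a≤b) (fin a≤v) (fin e) with a ℕ.<? b
    ... | yes a<b = ω (ℕP.+-cancelʳ-≤ (n * a) n vn (begin
          n + n * a      ≡⟨ sym (ℕP.*-suc n a) ⟩
          n * suc a      ≤⟨ ℕP.*-monoʳ-≤ n a<b ⟩
          n * b          ≤⟨ ℕP.m≤n+m (n * b) v ⟩
          v + n * b      ≡⟨ sym e ⟩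
          vn + n * a     ∎))
      where open ℕP.≤-Reasoning
    ... | no a≮b with ℕP.≤-antisym a≤b (ℕP.≮⇒≥ a≮b)
    ...   | refl = fin (≤-trans a≤v (ℕP.≤-reflexive (ℕP.+-cancelʳ-≡ (n * a) v vn (sym e))))
    coordinate ω _ (ω n≤vn) = ω n≤vn

module OmegaVASS {k : ℕ} (V : VASS k) where
  open VASS V

  Cfg : Set
  Cfg = Fin m × Vec ℕω k

  _≤C_ : Cfg → Cfg → Set
  c ≤C d = proj₁ c ≡ proj₁ d × proj₂ c ≤Ω proj₂ d

  ≤C-refl : ∀ {c} → c ≤C c
  ≤C-refl = refl , ≤Ω-refl

  ≤C-trans : ∀ {c d e} → c ≤C d → d ≤C e → c ≤C e
  ≤C-trans (p , q) (p' , q') = trans p p' , ≤Ω-trans q q'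

  _≤C?_ : ∀ c d → Dec (c ≤C d)
  (q , X) ≤C? (q' , Y) with q F.≟ q' | PW.decidable _≤ω?_ X Y
  ... | yes a | yes b = yes (a , b)
  ... | no ¬a | _     = no λ z → ¬a (proj₁ z)
  ... | _     | no ¬b = no λ z → ¬b (proj₂ z)

  _≟C_ : (c d : Cfg) → Dec (c ≡ d)
  _≟C_ = Data.Product.Properties.≡-dec F._≟_ (Data.Vec.Properties.≡-dec (Data.Maybe.Properties.≡-dec ℕ._≟_))

  stepω : Fin nT → Cfg → Maybe Cfg
  stepω t (q , X) with q F.≟ src t | PW.decidable (λ a x → just a ≤ω? x) (pre t) X
  ... | yes _ | yes _ = just (tgt t , shiftΩ (pre t) (post t) X)
  ... | _     | _     = nothing

  stepω-just : ∀ t q X {Y} → stepω t (q , X) ≡ just Y →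
               q ≡ src t × Enabled (pre t) X × (tgt t , shiftΩ (pre t) (post t) X) ≡ Y
  stepω-just t q X eq with q F.≟ src t | PW.decidable (λ a x → just a ≤ω? x) (pre t) X
  stepω-just t q X refl | yes q≡ | yes en = q≡ , en , refl

  stepω-yes : ∀ t X → Enabled (pre t) X → stepω t (src t , X) ≡ just (tgt t , shiftΩ (pre t) (post t) X)
  stepω-yes t X en with src t F.≟ src t | PW.decidable (λ a x → just a ≤ω? x) (pre t) X
  ... | yes _ | yes _  = refl
  ... | no ne | _      = ⊥-elim (ne refl)
  ... | yes _ | no ¬en = ⊥-elim (¬en en)

  Ω : OFTS
  Ω = record
    { State  = Cfg
    ; _⊑_    = _≤C_
    ; isPO   = record
      { isPreorder = record
        { isEquivalence = isEquivalence
        ; reflexive     = λ { refl → ≤C-refl }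
        ; trans         = ≤C-trans }
      ; antisym = λ { {q , X} (refl , p) (_ , p') → cong (q ,_) (≤Ω-antisym p p') } }
    ; nF     = nT
    ; apply  = stepω
    ; dom-up = λ { t {q , X} {.q , Y} (refl , X≤Y) eq →
        let (q≡ , en , _) = stepω-just t q X eq in
        (tgt t , shiftΩ (pre t) (post t) Y) ,
        subst (λ r → stepω t (r , Y) ≡ just (tgt t , shiftΩ (pre t) (post t) Y)) (sym q≡)
              (stepω-yes t Y (PW.trans ≤ω-trans en X≤Y)) }
    ; mono   = λ { t {q , X} {.q , Y} (refl , X≤Y) eqx eqy →
        let (_ , _ , ex) = stepω-just t q X eqx
            (_ , _ , ey) = stepω-just t q Y eqy
        in subst₂ _≤C_ ex ey (refl , shiftΩ-mono (pre t) (post t) X≤Y) }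
    }

  runω : List (Fin nT) → Cfg → Maybe Cfg
  runω = run Ω

  VX : OFTS
  VX = VASSOFTS V

  runω-SameShape : ∀ u M {M'} → runω u M ≡ just M' → SameShapeΩ (proj₂ M) (proj₂ M')
  runω-SameShape []      M refl = SameShapeΩ-refl
  runω-SameShape (t ∷ u) (q , X) eq with run-step⁻ Ω t u (q , X) eq
  ... | M₁ , fired , rest with stepω-just t q X fired
  ... | _ , _ , refl = SameShapeΩ-trans (SameShapeΩ-shift (pre t) (post t) X) (runω-SameShape u _ rest)

  -- Total precondition weight of a word: enough tokens for it to fire.
  cost : List (Fin nT) → ℕ
  cost []      = 0
  cost (t ∷ u) = Vec.sum (pre t) + cost u

  follow : ∀ u T (v : Vec ℕ k) (M M' : Cfg) → runω u M ≡ just M' → DominatesΩ (cost u + T) v (proj₂ M) →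
           ∃[ v' ] run VX u (proj₁ M , v) ≡ just (proj₁ M' , v') × TracksΩ T v (proj₂ M) v' (proj₂ M')
  follow []      T v M .M refl dom = v , refl , tracks-refl ≤-refl dom
  follow (t ∷ u) T v (q , X) M' eq dom with run-step⁻ Ω t u (q , X) eq
  ... | M₁ , fired , rest with stepω-just t q X fired
  ... | refl , en , refl =
    let dom' = subst (λ z → DominatesΩ z v X) (ℕP.+-assoc (Vec.sum (pre t)) (cost u) T) dom
        (a≤v , tr₁) = track-stepΩ (cost u + T) (Vec.sum (pre t)) (pre t) (post t) v X (≤-sum (pre t)) en dom'
        (v' , r , tr₂) = follow u T (shift (pre t) (post t) v) (tgt t , shiftΩ (pre t) (post t) X) M' rest
                                (tracks-dominates dom' tr₁)
    in v' , trans (run-step VX t u (src t , v) (vassStep-yes (src t) (tgt t) (pre t) (post t) v a≤v)) r ,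
       tracks-trans tr₁ tr₂

  Pump : Cfg → List (List (Fin nT)) → Cfg → Set
  Pump M ws M' = ∀ n → ∃[ N ] ∀ v → DominatesΩ N v (proj₂ M) →
    ∃[ w ] ∃[ v' ] InStars ws w × run VX w (proj₁ M , v) ≡ just (proj₁ M' , v') × DominatesΩ n v' (proj₂ M')

  pump-run : ∀ u M M' → runω u M ≡ just M' → Pump M (u ∷ []) M'
  pump-run u M M' eq n = cost u + n , λ v dom →
    let (v' , r , tr) = follow u n v M M' eq dom in
    (u ^^ 1) ++ [] , v' , more 1 done ,
    subst (λ z → run VX z (proj₁ M , v) ≡ just (proj₁ M' , v'))
          (sym (trans (++-identityʳ (u ++ [])) (++-identityʳ u))) r ,
    tracks-dominates dom tr

  pump-++ : ∀ {M ws₁ M₁ ws₂ M₂} → Pump M ws₁ M₁ → Pump M₁ ws₂ M₂ → Pump M (ws₁ ++ ws₂) M₂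
  pump-++ {M} P Q n =
    let (N₂ , f₂) = Q n
        (N₁ , f₁) = P N₂
    in N₁ , λ v dom →
      let (w₁ , v₁ , i₁ , r₁ , d₁) = f₁ v dom
          (w₂ , v₂ , i₂ , r₂ , d₂) = f₂ v₁ d₁
      in w₁ ++ w₂ , v₂ , stars-++ i₁ i₂ , trans (run-++ VX w₁ w₂ (proj₁ M , v) r₁) r₂ , d₂

  module _ (u : List (Fin nT)) (q : Fin m) (H C : Vec ℕω k)
           (loop : runω u (q , H) ≡ just (q , C)) (grow : GrowsΩ H C) where

    iterate : ∀ j T v → DominatesΩ (j * cost u + T) v H →
              ∃[ vj ] run VX (u ^^ j) (q , v) ≡ just (q , vj) × IteratedΩ j T v H C vj
    iterate zero    T v dom = v , refl , iterated-zero grow dom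
    iterate (suc j) T v dom =
      let dom' = subst (λ z → DominatesΩ z v H) (ℕP.+-assoc (cost u) (j * cost u) T) dom
          (v₁ , r₁ , tr) = follow u (j * cost u + T) v (q , H) (q , C) loop dom'
          (vj , r₂ , it) = iterate j T v₁ (loop-dominates grow dom' tr)
      in vj , trans (run-++ VX u (u ^^ j) (q , v) r₁) r₂ , iterated-suc tr it

    pump-accelerate : Pump (q , H) (u ∷ []) (q , accelerate H C)
    pump-accelerate n = n * cost u + n , λ v dom →
      let (vn , r , it) = iterate n n v dom in
      (u ^^ n) ++ [] , vn , more n done ,
      subst (λ z → run VX z (q , v) ≡ just (q , vn)) (sym (++-identityʳ (u ^^ n))) r ,
      iterated-dominates n grow (DominatesΩ-weaken z≤n dom) it

-- LexBelow d f g compares (f d , f (d-1) , … , f 0) and (g d , … , g 0)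
-- lexicographically, most significant first.
LexBelow : ℕ → (ℕ → ℕ) → (ℕ → ℕ) → Set
LexBelow zero    = _<_ on (λ f → f 0)
LexBelow (suc d) = ×-Lex _≡_ _<_ (LexBelow d) on (λ f → f (suc d) , f)

LexBelow-wf : ∀ d → WellFounded (LexBelow d)
LexBelow-wf zero    = On.wellFounded (λ f → f 0) <-wellFounded
LexBelow-wf (suc d) = On.wellFounded (λ f → f (suc d) , f) (×-wellFounded <-wellFounded (LexBelow-wf d))

LexBelow-intro : ∀ d e (f g : ℕ → ℕ) → e ≤ d → f e < g e → (∀ d' → e < d' → d' ≤ d → f d' ≡ g d') →
                 LexBelow d f g
LexBelow-intro zero    zero f g z≤n lt agree = lt
LexBelow-intro (suc d) e    f g e≤d lt agree with e ℕ.≟ suc d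
... | yes refl = inj₁ lt
... | no e≢ = inj₂ (agree (suc d) e<d ≤-refl ,
                    LexBelow-intro d e f g (ℕP.≤-pred e<d) lt (λ d' e<d' d'≤d → agree d' e<d' (≤-trans d'≤d (n≤1+n d))))
  where e<d = ℕP.≤∧≢⇒< e≤d e≢

-- Components: sets of ω-vectors with some coordinates fixed and the
-- others ranging over ℕ.
data Spec : Set where
  free  : Spec
  fixed : ℕω → Spec

data _∈S_ : ℕω → Spec → Set where
  free  : ∀ {a} → just a ∈S free
  fixed : ∀ {x} → x ∈S fixed x

_∈Sᵛ_ : ∀ {n} → Vec ℕω n → Vec Spec n → Set
_∈Sᵛ_ = Pointwise _∈S_

dim : ∀ {n} → Vec Spec n → ℕ
dim []            = 0
dim (free ∷ S)    = suc (dim S)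
dim (fixed _ ∷ S) = dim S

dim-≤ : ∀ {n} (S : Vec Spec n) → dim S ≤ n
dim-≤ []            = z≤n
dim-≤ (free ∷ S)    = s≤s (dim-≤ S)
dim-≤ (fixed _ ∷ S) = ≤-trans (dim-≤ S) (n≤1+n _)

-- The vectors of S that are not above c (for c ∈ S), as a list of
-- components of one dimension less: some free coordinate i is fixed to
-- a value below cᵢ.
residue : ∀ {n} → Vec Spec n → Vec ℕω n → List (Vec Spec n)
residue []            []            = []
residue (free ∷ S)    (just a ∷ c)  = map (λ a' → fixed (just a') ∷ S) (upTo a) ++ map (free ∷_) (residue S c)
residue (free ∷ S)    (nothing ∷ c) = map (free ∷_) (residue S c)
residue (fixed x ∷ S) (_ ∷ c)       = map (fixed x ∷_) (residue S c)

residue-dim : ∀ {n} (S : Vec Spec n) c → All (λ S' → suc (dim S') ≡ dim S) (residue S c)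
residue-dim []            []            = []
residue-dim (free ∷ S)    (just a ∷ c)  =
  AllP.++⁺ (AllP.map⁺ (All.universal (λ _ → refl) (upTo a)))
           (AllP.map⁺ (All.map (cong suc) (residue-dim S c)))
residue-dim (free ∷ S)    (nothing ∷ c) = AllP.map⁺ (All.map (cong suc) (residue-dim S c))
residue-dim (fixed x ∷ S) (_ ∷ c)       = AllP.map⁺ (residue-dim S c)

residue-complete : ∀ {n} (S : Vec Spec n) (c X : Vec ℕω n) → c ∈Sᵛ S → X ∈Sᵛ S → ¬ c ≤Ω X →
                   Any (X ∈Sᵛ_) (residue S c)
residue-complete [] [] [] [] [] c≰X = ⊥-elim (c≰X [])
residue-complete (s ∷ S) (x ∷ c) (y ∷ X) (x∈ ∷ c∈) (y∈ ∷ X∈) c≰X with x ≤ω? y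
residue-complete (free ∷ S) (just a ∷ c) (just b ∷ X) (free ∷ c∈) (free ∷ X∈) c≰X | yes a≤b =
  AnyP.++⁺ʳ _ (AnyP.map⁺ (Any.map (free ∷_) (residue-complete S c X c∈ X∈ (λ c≤X → c≰X (a≤b ∷ c≤X)))))
residue-complete (fixed x ∷ S) (.x ∷ c) (.x ∷ X) (fixed ∷ c∈) (fixed ∷ X∈) c≰X | yes x≤x =
  AnyP.map⁺ (Any.map (fixed ∷_) (residue-complete S c X c∈ X∈ (λ c≤X → c≰X (x≤x ∷ c≤X))))
residue-complete (free ∷ S) (just a ∷ c) (just b ∷ X) (free ∷ c∈) (free ∷ X∈) c≰X | no a≰b =
  AnyP.++⁺ˡ (AnyP.map⁺ (lose (∈-upTo⁺ (ℕP.≰⇒> (λ a≤b → a≰b (fin a≤b)))) (fixed ∷ X∈)))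
residue-complete (fixed x ∷ S) (.x ∷ c) (.x ∷ X) (fixed ∷ c∈) (fixed ∷ X∈) c≰X | no x≰x = ⊥-elim (x≰x ≤ω-refl)

shapeOf : ∀ {n} → Vec ℕω n → Vec Spec n
shapeOf []            = []
shapeOf (just _ ∷ X)  = free ∷ shapeOf X
shapeOf (nothing ∷ X) = fixed nothing ∷ shapeOf X

∈shapeOf : ∀ {n} {X Y : Vec ℕω n} → SameShapeΩ X Y → Y ∈Sᵛ shapeOf X
∈shapeOf []         = []
∈shapeOf (fin ∷ ps) = free ∷ ∈shapeOf ps
∈shapeOf (ω ∷ ps)   = fixed ∷ ∈shapeOf ps

module Counting {A : Set} (δ : A → ℕ) where

  indicator : ℕ → ℕ → ℕ
  indicator e d with e ℕ.≟ d
  ... | yes _ = 1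
  ... | no  _ = 0

  indicator-≡ : ∀ e → indicator e e ≡ 1
  indicator-≡ e with e ℕ.≟ e
  ... | yes _ = refl
  ... | no ne = ⊥-elim (ne refl)

  indicator-≢ : ∀ e d → e ≢ d → indicator e d ≡ 0
  indicator-≢ e d e≢d with e ℕ.≟ d
  ... | yes e≡d = ⊥-elim (e≢d e≡d)
  ... | no  _   = refl

  count : List A → ℕ → ℕ
  count []      d = 0
  count (C ∷ D) d = indicator (δ C) d + count D d

  count-++ : ∀ D E d → count (D ++ E) d ≡ count D d + count E d
  count-++ []      E d = refl
  count-++ (C ∷ D) E d = trans (cong (indicator (δ C) d +_) (count-++ D E d))
                               (sym (ℕP.+-assoc (indicator (δ C) d) (count D d) (count E d)))

  count-─ : ∀ {P : A → Set} D (pos : Any P D) d → count D d ≡ indicator (δ (Any.lookup pos)) d + count (D ─ pos) d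
  count-─ (C ∷ D) (here _)    d = refl
  count-─ (C ∷ D) (there pos) d =
    trans (cong (indicator (δ C) d +_) (count-─ D pos d))
          (x∙yz≈y∙xz (indicator (δ C) d) (indicator (δ (Any.lookup pos)) d) (count (D ─ pos) d))

  count-lower : ∀ L e → All (λ C → suc (δ C) ≡ e) L → ∀ d → e ≤ d → count L d ≡ 0
  count-lower []      e []       d e≤d = refl
  count-lower (C ∷ L) e (p ∷ ps) d e≤d =
    trans (cong (_+ count L d) (indicator-≢ (δ C) d (λ δ≡d → ℕP.<-irrefl δ≡d (≤-trans (ℕP.≤-reflexive p) e≤d))))
          (count-lower L e ps d e≤d)

  count-refine : ∀ d {P : A → Set} D (pos : Any P D) L → δ (Any.lookup pos) ≤ d →
                 All (λ C → suc (δ C) ≡ δ (Any.lookup pos)) L →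
                 LexBelow d (count ((D ─ pos) ++ L)) (count D)
  count-refine d D pos L e≤d lower =
    LexBelow-intro d e (count ((D ─ pos) ++ L)) (count D) e≤d (ℕP.≤-reflexive (trans (cong suc at-e) (sym at-e'))) above-e
    where
      e = δ (Any.lookup pos)
      new-count : ∀ d' → e ≤ d' → count ((D ─ pos) ++ L) d' ≡ count (D ─ pos) d'
      new-count d' e≤d' = trans (count-++ (D ─ pos) L d')
                                (trans (cong (count (D ─ pos) d' +_) (count-lower L e lower d' e≤d'))
                                       (ℕP.+-identityʳ _))
      at-e : count ((D ─ pos) ++ L) e ≡ count (D ─ pos) e
      at-e = new-count e ≤-refl
      above-e : ∀ d' → e < d' → d' ≤ d → count ((D ─ pos) ++ L) d' ≡ count D d'
      above-e d' e<d' _ = trans (new-count d' (ℕP.<⇒≤ e<d'))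
        (sym (trans (count-─ D pos d') (cong (_+ count (D ─ pos) d') (indicator-≢ e d' (ℕP.<⇒≢ e<d')))))
      at-e' : count D e ≡ suc (count (D ─ pos) e)
      at-e' = trans (count-─ D pos e) (cong (_+ count (D ─ pos) e) (indicator-≡ e))

─-Any : ∀ {A : Set} {P Q : A → Set} {xs : List A} (pos : Any P xs) → Any Q xs →
        Any Q (xs ─ pos) ⊎ Q (Any.lookup pos)
─-Any (here _)    (here q)  = inj₂ q
─-Any (here _)    (there q) = inj₁ q
─-Any (there pos) (here q)  = inj₁ (here q)
─-Any (there pos) (there q) with ─-Any pos q
... | inj₁ r = inj₁ (there r)
... | inj₂ r = inj₂ r

module KarpMiller {k : ℕ} (V : VASS k) where
  open VASS V
  open OmegaVASS V

  Pumped : Set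
  Pumped = List (List (Fin nT)) × Cfg

  Pumps : Cfg → List Pumped → Set
  Pumps M = All (λ e → Pump M (proj₁ e) (proj₂ e))

  Below : Cfg → List Pumped → Set
  Below Y = Any (λ e → Y ≤C proj₂ e)

  CoverClaim : Cfg → Set
  CoverClaim M = Σ (List Pumped) λ L → Pumps M L × (∀ w Y → runω w M ≡ just Y → Below Y L)

  Comp : Set
  Comp = Fin m × Vec Spec k

  _∈C_ : Cfg → Comp → Set
  x ∈C C = proj₁ x ≡ proj₁ C × proj₂ x ∈Sᵛ proj₂ C

  open Counting (λ (C : Comp) → dim (proj₂ C))

  -- An ancestor on a branch p: p = pre ++ loop, and pre reaches h.
  Ancestor : Set
  Ancestor = List (Fin nT) × List (Fin nT) × Cfg

  config : Ancestor → Cfg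
  config (_ , _ , h) = h

  extend : Fin nT → Ancestor → Ancestor
  extend t (pre , loop , h) = pre , loop ++ t ∷ [] , h

  module Explore (M : Cfg) (IH : ∀ M' → finite (proj₂ M') < finite (proj₂ M) → CoverClaim M') where

    AncestorOf : List (Fin nT) → Ancestor → Set
    AncestorOf p (pre , loop , h) = pre ++ loop ≡ p × runω pre M ≡ just h

    record Node (p : List (Fin nT)) (c : Cfg) : Set where
      field
        reached   : runω p M ≡ just c
        ancestors : List Ancestor
        valid     : All (AncestorOf p) ancestors
    open Node

    Covers : List Ancestor → List Comp → Set
    Covers as D = ∀ x → SameShapeΩ (proj₂ M) (proj₂ x) → ¬ Any (λ a → config a ≤C x) as → Any (x ∈C_) D

    CoveredFrom : List Pumped → ℕ → Cfg → Set
    CoveredFrom L len c = ∀ r Y → runω r c ≡ just Y →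
      Below Y L ⊎ ∃[ w ] length w < len + length r × runω w M ≡ just Y

    Result : ℕ → Cfg → Set
    Result len c = Σ (List Pumped) λ L → Pumps M L × CoveredFrom L len c

    -- c' repeats an ancestor: its runs are runs of that ancestor, reached
    -- by a shorter path.
    loop-back : ∀ {p t c'} a → AncestorOf p a → config a ≡ c' → Result (length (p ++ t ∷ [])) c'
    loop-back {p} {t} (pre , loop , _) (split , reached) refl = [] , [] , λ r Y rY →
      inj₂ (pre ++ r , shorter r , trans (run-++ Ω pre r M reached) rY)
      where
        open ℕP.≤-Reasoning
        shorter : ∀ r → length (pre ++ r) < length (p ++ t ∷ []) + length r
        shorter r = begin-strict
          length (pre ++ r)            ≡⟨ length-++ pre ⟩
          length pre + length r        ≤⟨ ℕP.+-monoˡ-≤ (length r) (≤-trans (ℕP.m≤m+n (length pre) (length loop))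
                                            (ℕP.≤-reflexive (trans (sym (length-++ pre)) (cong length split)))) ⟩
          length p + length r          <⟨ ℕP.+-monoˡ-< (length r) (ℕP.n<1+n (length p)) ⟩
          suc (length p) + length r    ≡⟨ cong (_+ length r) (sym (trans (length-++ p) (ℕP.+-comm (length p) 1))) ⟩
          length (p ++ t ∷ []) + length r ∎

    -- c' strictly dominates an ancestor h: the loop from h to c' is
    -- accelerated, which creates a new ω, and the induction hypothesis
    -- applies to the accelerated configuration.
    accelerate-child : ∀ {p c t c'} a → runω p M ≡ just c → stepω t c ≡ just c' →
                       AncestorOf p a → config a ≤C c' → config a ≢ c' → Result (length (p ++ t ∷ [])) c'
    accelerate-child {p} {c} {t} {qc , C} (pre , loop , (qh , H)) rp step (split , reached) (refl , H≤C) H≢c' =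
      map via LA , AllP.map⁺ (All.map (λ P → pump-++ (pump-run pre M (qh , H) reached) (pump-++ pump-A P)) pumpsA) ,
      λ r Y rY → let (Y' , rY' , Y≤Y') = run-mono Ω r (refl , accelerate-≥ grow) rY
                 in inj₁ (AnyP.map⁺ (Any.map (≤C-trans Y≤Y') (coverA r Y' rY')))
      where
        u = loop ++ t ∷ []
        loop-run : runω u (qh , H) ≡ just (qh , C)
        loop-run = let (y , r₁ , r₂) = run-++⁻ Ω pre loop M (subst (λ z → runω z M ≡ just c) (sym split) rp)
                       r₂' = subst (λ z → runω loop z ≡ just c) (Data.Maybe.Properties.just-injective (trans (sym r₁) reached)) r₂
                   in trans (run-++ Ω loop (t ∷ []) (qh , H) r₂') (run-step Ω t [] c step)
        grow : GrowsΩ H C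
        grow = grows H≤C (runω-SameShape u (qh , H) loop-run)
        A : Cfg
        A = qh , accelerate H C
        fewer : finite (accelerate H C) < finite (proj₂ M)
        fewer = ≤-trans (finite-accelerate-< grow (λ H≡C → H≢c' (cong (qh ,_) H≡C)))
                        (ℕP.≤-reflexive (sym (finite-SameShape (runω-SameShape pre M reached))))
        pump-A = pump-accelerate u qh H C loop-run grow
        claimA = IH A fewer
        LA = proj₁ claimA
        pumpsA = proj₁ (proj₂ claimA)
        coverA = proj₂ (proj₂ claimA)
        via : Pumped → Pumped
        via e = (pre ∷ u ∷ proj₁ e) , proj₂ e

    -- c' lies above no ancestor: it becomes a new node.  The component
    -- containing c' is replaced by its residue, which lowers the counts.
    descend : ∀ {p c} D (n : Node p c) → Covers (ancestors n) D → ∀ t c' → stepω t c ≡ just c' →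
              ¬ Any (λ a → config a ≤C c') (ancestors n) →
              Σ (List Comp) λ D' → LexBelow k (count D') (count D) ×
              Σ (Node (p ++ t ∷ []) c') λ n' → Covers (ancestors n') D'
    descend {p} {c} D n cov t c' step fresh =
      D' , count-refine k D pos R (dim-≤ (proj₂ C)) (AllP.map⁺ (residue-dim (proj₂ C) (proj₂ c'))) ,
      record { reached = reached' ; ancestors = as' ; valid = valid' } , cov'
      where
        one-step : runω (t ∷ []) c ≡ just c'
        one-step = run-step Ω t [] c step
        reached' : runω (p ++ t ∷ []) M ≡ just c'
        reached' = trans (run-++ Ω p (t ∷ []) M (reached n)) one-step
        shape' : SameShapeΩ (proj₂ M) (proj₂ c')
        shape' = runω-SameShape (p ++ t ∷ []) M reached'
        pos : Any (c' ∈C_) D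
        pos = cov c' shape' fresh
        C = Any.lookup pos
        c'∈C : c' ∈C C
        c'∈C = AnyP.lookup-result pos
        R = map (λ S → (proj₁ C , S)) (residue (proj₂ C) (proj₂ c'))
        D' = (D ─ pos) ++ R
        as' = map (extend t) (ancestors n) ++ (p ++ t ∷ [] , [] , c') ∷ []
        valid' : All (AncestorOf (p ++ t ∷ [])) as'
        valid' = AllP.++⁺ (AllP.map⁺ (All.map (λ { {pre , loop , h} (split , r) →
                             trans (sym (++-assoc pre loop (t ∷ []))) (cong (_++ t ∷ []) split) , r }) (valid n)))
                          ((++-identityʳ _ , reached') ∷ [])
        cov' : Covers as' D'
        cov' x shape above-none with ─-Any pos (cov x shape (λ a → above-none (AnyP.++⁺ˡ (AnyP.map⁺ a))))
        ... | inj₁ x∈rest = AnyP.++⁺ˡ x∈rest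
        ... | inj₂ x∈C = AnyP.++⁺ʳ (D ─ pos) (AnyP.map⁺ (Any.map (λ S∋x → proj₁ x∈C , S∋x)
                (residue-complete (proj₂ C) (proj₂ c') (proj₂ x) (proj₂ c'∈C) (proj₂ x∈C)
                   (λ c'≤x → above-none (AnyP.++⁺ʳ (map (extend t) (ancestors n))
                                           (here (trans (proj₁ c'∈C) (sym (proj₁ x∈C)) , c'≤x)))))))

    -- The exploration: every node yields its own run as a pump, plus the
    -- results of its children; it terminates since each new node lowers
    -- the counts of D.
    explore : ∀ D → Acc (LexBelow k) (count D) → ∀ {p c} (n : Node p c) → Covers (ancestors n) D →
              Result (length p) c
    explore D (acc smaller) {p} {c} n cov =
      (p ∷ [] , c) ∷ concatMap (λ t → proj₁ (via t)) (allFin nT) ,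
      pump-run p M c (reached n) ∷ AllP.concat⁺ (AllP.map⁺ (All.universal (λ t → proj₁ (proj₂ (via t))) (allFin nT))) ,
      covered
      where
        child : ∀ t c' → stepω t c ≡ just c' → Result (length (p ++ t ∷ [])) c'
        child t c' step with Any.any? (λ a → config a ≤C? c') (ancestors n)
        ... | no fresh =
          let (D' , lower , n' , cov') = descend D n cov t c' step fresh
          in explore D' (smaller lower) n' cov'
        ... | yes below with All.lookupAny (valid n) below
        ...   | anc , h≤c' with config (Any.lookup below) ≟C c'
        ...     | yes h≡c' = loop-back (Any.lookup below) anc h≡c'
        ...     | no h≢c'  = accelerate-child (Any.lookup below) (reached n) step anc h≤c' h≢c'

        via : ∀ t → Σ (List Pumped) λ L → Pumps M L × (∀ c' → stepω t c ≡ just c' → CoveredFrom L (length (p ++ t ∷ [])) c')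
        via t with stepω t c in step
        ... | nothing = [] , [] , λ _ ()
        ... | just c' = let (L , P , cov) = child t c' step in L , P , λ { _ refl → cov }

        length-step : ∀ p t (r : List (Fin nT)) → length (p ++ t ∷ []) + length r ≡ length p + length (t ∷ r)
        length-step p t r = trans (cong (_+ length r) (length-++ p)) (ℕP.+-assoc (length p) 1 (length r))

        covered : CoveredFrom ((p ∷ [] , c) ∷ concatMap (λ t → proj₁ (via t)) (allFin nT)) (length p) c
        covered []      Y refl = inj₁ (here ≤C-refl)
        covered (t ∷ r) Y rY with run-step⁻ Ω t r c rY
        ... | c' , step , rest with proj₂ (proj₂ (via t)) c' step r Y rest
        ...   | inj₁ below = inj₁ (there (AnyP.concat⁺ (AnyP.map⁺ (lose (∈-allFin t) below))))
        ...   | inj₂ (w , shorter , rw) = inj₂ (w , subst (length w <_) (length-step p t r) shorter , rw)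


    -- Starting at the root, shorter runs are eventually covered directly.
    root : CoverClaim M
    root = L , P , WF.All.wfRec (On.wellFounded length <-wellFounded) _ Covered step
      where
        D₀ = map (λ q → (q , shapeOf (proj₂ M))) (allFin m)
        n₀ : Node [] M
        n₀ = record { reached = refl ; ancestors = ([] , [] , M) ∷ [] ; valid = (refl , refl) ∷ [] }
        cov₀ : Covers (ancestors n₀) D₀
        cov₀ x shape _ = AnyP.map⁺ (lose (∈-allFin (proj₁ x)) (refl , ∈shapeOf shape))
        result = explore D₀ (LexBelow-wf k (count D₀)) n₀ cov₀
        L = proj₁ result
        P = proj₁ (proj₂ result)
        Covered : List (Fin nT) → Set
        Covered w = ∀ Y → runω w M ≡ just Y → Below Y L
        step : ∀ w → (∀ {w'} → length w' < length w → Covered w') → Covered w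
        step w shorter-covered Y rY with proj₂ (proj₂ result) w Y rY
        ... | inj₁ below = below
        ... | inj₂ (w' , shorter , rw') = shorter-covered {w'} shorter Y rw'

  claim : ∀ M → CoverClaim M
  claim = WF.All.wfRec (On.wellFounded (λ M → finite (proj₂ M)) <-wellFounded) _ CoverClaim
            (λ M IH → Explore.root M (λ M' fewer → IH fewer))

  embedΩ : ∀ {n} → Vec ℕ n → Vec ℕω n
  embedΩ = Vec.map just

  embed : Fin m × Vec ℕ k → Cfg
  embed (q , v) = q , embedΩ v

  shiftΩ-embed : ∀ {n} (a b v : Vec ℕ n) → shiftΩ a b (embedΩ v) ≡ embedΩ (shift a b v)
  shiftΩ-embed []       []       []       = refl
  shiftΩ-embed (a ∷ as) (b ∷ bs) (v ∷ vs) = cong (just (v ∸ a + b) ∷_) (shiftΩ-embed as bs vs)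

  enabled-embed : ∀ {n} {a v : Vec ℕ n} → a ≤ᵛ v → Enabled a (embedΩ v)
  enabled-embed []       = []
  enabled-embed (p ∷ ps) = fin p ∷ enabled-embed ps

  dominates-embed : ∀ {n N} (v : Vec ℕ n) → DominatesΩ N v (embedΩ v)
  dominates-embed []      = []
  dominates-embed (x ∷ v) = fin ≤-refl ∷ dominates-embed v

  run-embed : ∀ w x {y} → run VX w x ≡ just y → runω w (embed x) ≡ just (embed y)
  run-embed []      x       refl = refl
  run-embed (t ∷ w) (q , v) eq with run-step⁻ VX t w (q , v) eq
  ... | y₁ , fired , rest with vassStep-just (src t) (tgt t) (pre t) (post t) q v fired
  ... | refl , a≤v , refl =
    trans (run-step Ω t w (q , embedΩ v)
            (trans (stepω-yes t (embedΩ v) (enabled-embed a≤v))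
                   (cong (λ z → just (tgt t , z)) (shiftΩ-embed (pre t) (post t) v))))
          (run-embed w _ rest)

  below-dominating : ∀ {n N} (y v : Vec ℕ n) {Z} → AllV (_≤ N) y → embedΩ y ≤Ω Z → DominatesΩ N v Z → y ≤ᵛ v
  below-dominating []       []       _        []           []              = []
  below-dominating (y ∷ ys) (v ∷ vs) (l ∷ ls) (fin p ∷ ps) (fin q ∷ qs) = ≤-trans p q ∷ below-dominating ys vs ls ps qs
  below-dominating (y ∷ ys) (v ∷ vs) (l ∷ ls) (top ∷ ps)   (ω q ∷ qs)   = ≤-trans l q ∷ below-dominating ys vs ls ps qs

  stars-concat : ∀ {P : Pumped → Set} (L : List Pumped) (pos : Any P L) {w} →
                 InStars (proj₁ (Any.lookup pos)) w → InStars (concatMap proj₁ L) w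
  stars-concat (e ∷ L) (here _)    p = stars-padʳ (concatMap proj₁ L) p
  stars-concat (e ∷ L) (there pos) p = stars-padˡ (proj₁ e) (stars-concat L pos p)

  -- Every VASS has a bounded cover: the blocks of all pumps from x₀.
  boundedCover : ∀ x₀ → Σ (List (List (Fin nT))) (BoundedCover VX x₀)
  boundedCover (q₀ , v₀) = concatMap proj₁ L , covered
    where
      cl = claim (embed (q₀ , v₀))
      L = proj₁ cl
      pumps = proj₁ (proj₂ cl)
      dominated = proj₂ (proj₂ cl)
      covered : BoundedCover VX (q₀ , v₀) (concatMap proj₁ L)
      covered (q , v) w (qy , vy) (refl , v≤v₀) r =
        let (Y' , rY' , y≤Y') = run-mono Ω w (refl , PW.map⁺ fin v≤v₀) (run-embed w (q , v) r)
            below = dominated w Y' rY'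
            (pump , Y'≤e) = All.lookupAny pumps below
            (N , instances) = pump (Vec.sum vy)
            (w' , v' , w'∈ , r' , dom) = instances v₀ (dominates-embed v₀)
        in w' , (proj₁ (proj₂ (Any.lookup below)) , v') , stars-concat L below w'∈ , r' ,
           (trans (proj₁ y≤Y') (proj₁ Y'≤e) , below-dominating vy v' (≤-sum vy) (≤Ω-trans (proj₂ y≤Y') (proj₂ Y'≤e)) dom)

module PetriAsVASS {k : ℕ} (N : PetriNet k) where
  open PetriNet N

  asVASS : VASS k
  asVASS = record { m = 1 ; nT = nT ; src = λ _ → F.zero ; tgt = λ _ → F.zero ; pre = pre ; post = post }

  PN VN : OFTS
  PN = PetriNetOFTS N
  VN = VASSOFTS asVASS

  to-VASS : ∀ w x {y} → run PN w x ≡ just y → run VN w (F.zero , x) ≡ just (F.zero , y)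
  to-VASS []      x refl = refl
  to-VASS (t ∷ w) x eq with guard (pre t) (post t) x
  ... | just x₁ = to-VASS w x₁ eq

  from-VASS : ∀ w x {q y} → run VN w (F.zero , x) ≡ just (q , y) → run PN w x ≡ just y
  from-VASS []      x refl = refl
  from-VASS (t ∷ w) x eq with guard (pre t) (post t) x
  ... | just x₁ = from-VASS w x₁ eq

  boundedCover : ∀ x₀ → Σ (List (List (Fin nT))) (BoundedCover PN x₀)
  boundedCover x₀ with KarpMiller.boundedCover asVASS (F.zero , x₀)
  ... | ws , covered = ws , λ x w y x≤x₀ r →
    let (w' , (_ , y') , w'∈ , r' , (_ , y≤y')) = covered (F.zero , x) w (F.zero , y) (refl , x≤x₀) (to-VASS w x r)
    in w' , y' , w'∈ , from-VASS w' x₀ r' , y≤y'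

corollary5p27 : (∀ (k : ℕ) (N : PetriNet k) (x0 : Vec ℕ k) → CoverFlattable (PetriNetOFTS N) x0)
    × (∀ (k : ℕ) (V : VASS k) (x0 : Fin (VASS.m V) × Vec ℕ k) → CoverFlattable (VASSOFTS V) x0)
corollary5p27 =
  (λ k N x₀ → let (ws , bc) = PetriAsVASS.boundedCover N x₀ in boundedCover⇒coverFlattable _ x₀ ws bc) ,
  (λ k V x₀ → let (ws , bc) = KarpMiller.boundedCover V x₀ in boundedCover⇒coverFlattable _ x₀ ws bc)
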